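{- (LTL Correspondence Theorem) Let $S$ be an LTL' Sahlqvist formula with atoms $q_1,\ldots,q_k$. Then the local correspondent of $S$ at a path $w$ can be expressed in first-order terms: there is a first-order formula $\alpha(w)$ in the language with the binary relations $\leqslant,<$ and the function $\mathbf{S}$ on paths such that, for every transition system and every path $w$, $\forall Q_1\ldots\forall Q_k\, ST_w(S(q_1,\ldots,q_k))$ holds at $w$ if and only if $\alpha(w)$ holds.
   Context: Models: transition system $T=(S,\to)$ with $\to$ serial; paths = infinite $\to$-sequences; $w\leqslant v$ iff $v$ is a suffix of $w$ (starting at some index $i\geqslant1$); $w<v$ iff $w\leqslant v$, $w\neq v$; $\mathbf{S}(w)$ = path with first state dropped. Assignments give atoms sets of paths (via first states). LTL': $\phi::=q\mid\bot\mid\top\mid\neg\phi\mid\phi\wedge\phi\mid\phi\vee\phi\mid G\phi\mid F_x\phi\mid\widehat{G}_{s,s'}\phi\mid X\phi$ ($x$ a path variable, $s\neq s'$ terms denoting paths). Standard translation (predicate $Q$ for each atom $q$): $ST_w(q)=Q(w)$; commutes with $\neg,\wedge,\vee$; $ST_w(G\phi)=\forall v(w\leqslant v\to ST_v\phi)$; $ST_w(F_x\phi)=\exists x(w\leqslant x\wedge ST_x\phi)$; $ST_w(\widehat{G}_{s,s'}\phi)=\forall v(s\leqslant v<s'\to ST_v\phi)$; $ST_w(X\phi)=ST_{\mathbf{S}(w)}\phi$. Second-order quantifiers $\forall Q_j$ range over sets of paths. LTL' boxed: $\boxplus_1\cdots\boxplus_n q$, $n\geqslant0$, each $\boxplus_i\in\{G,\widehat{G}_{s,s'},X\}$.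 LTL' positive: built from atoms, $\bot,\top$ with $\wedge,\vee,G,F_x,\widehat{G}_{s,s'},X$. LTL' negative: $\neg\phi$ with $\phi$ positive, or $\widehat{G}_{s,s'}N$ with $N$ negative. LTL' untied: $\phi::=A\mid N\mid\phi\wedge\phi\mid F_x\phi$ with $A$ boxed and $N$ negative. LTL' Sahlqvist formula: a conjunction $\bigwedge_{i}\neg E_i$ of negations of LTL' untied formulas $E_i$. -}

module Defs where

open import Data.Nat using (ℕ; zero; suc; _+_; _≟_)
open import Data.Product using (Σ; ∃; _×_; _,_)
open import Data.Sum using (_⊎_)
open import Data.Empty using (⊥)
open import Data.Unit using (⊤)
open import Relation.Nullary using (¬_; yes; no)
open import Relation.Binary.PropositionalEquality using (_≡_; _≢_)

record TS : Set₁ where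
  field
    State  : Set
    _⟶_    : State → State → Set
    serial : ∀ s → ∃ λ t → s ⟶ t

record Path (T : TS) : Set where
  constructor mkPath
  open TS T
  field
    seq   : ℕ → State
    valid : ∀ n → seq n ⟶ seq (suc n)
open Path public

module _ {T : TS} where

  _≈ₚ_ : Path T → Path T → Set
  w ≈ₚ v = ∀ n → seq w n ≡ seq v n

  drop : ℕ → Path T → Path T
  drop i w = mkPath (λ n → seq w (n + i)) (λ n → valid w (n + i))

  𝐒 : Path T → Path T
  𝐒 w = mkPath (λ n → seq w (suc n)) (λ n → valid w (suc n))

  _⩽_ : Path T → Path T → Set
  w ⩽ v = ∃ λ i → v ≈ₚ drop i w

  _⋖_ : Path T → Path T → Set
  w ⋖ v = (w ⩽ v) × ¬ (w ≈ₚ v)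

Var : Set
Var = ℕ

data Term : Set where
  var : Var → Term
  S   : Term → Term

Env : TS → Set
Env T = Var → Path T

⟦_⟧ₜ : {T : TS} → Term → Env T → Path T
⟦ var x ⟧ₜ ρ = ρ x
⟦ S t ⟧ₜ ρ = 𝐒 (⟦ t ⟧ₜ ρ)

_[_↦_] : {T : TS} → Env T → Var → Path T → Env T
(ρ [ x ↦ v ]) y with y ≟ x
... | yes _ = v
... | no _  = ρ y

data LTL : Set where
  atom : ℕ → LTL
  ⊥'   : LTL
  ⊤'   : LTL
  ¬'_  : LTL → LTL
  _∧'_ : LTL → LTL → LTL
  _∨'_ : LTL → LTL → LTL
  G    : LTL → LTL
  F    : Var → LTL → LTL
  Ĝ    : (s s' : Term) → s ≢ s' → LTL → LTL
  X    : LTL → LTL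

-- Valuations of the atoms: sets of paths (second-order variables Q_i)
Val : TS → Set₁
Val T = ℕ → Path T → Set

-- a predicate on paths is a *set of paths* when it respects path equality
RespVal : (T : TS) → Val T → Set
RespVal T V = ∀ i (v u : Path T) → v ≈ₚ u → V i v → V i u

ST : (T : TS) → Val T → Env T → Path T → LTL → Set
ST T V ρ w (atom i)     = V i w
ST T V ρ w ⊥'           = ⊥
ST T V ρ w ⊤'           = ⊤
ST T V ρ w (¬' φ)       = ¬ ST T V ρ w φ
ST T V ρ w (φ ∧' ψ)     = ST T V ρ w φ × ST T V ρ w ψ
ST T V ρ w (φ ∨' ψ)     = ST T V ρ w φ ⊎ ST T V ρ w ψ
ST T V ρ w (G φ)        = ∀ v → w ⩽ v → ST T V ρ v φ
ST T V ρ w (F x φ)      = ∃ λ v → (w ⩽ v) × ST T V (ρ [ x ↦ v ]) v φ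
ST T V ρ w (Ĝ s s' _ φ) = ∀ v → ⟦ s ⟧ₜ ρ ⩽ v → v ⋖ ⟦ s' ⟧ₜ ρ → ST T V ρ v φ
ST T V ρ w (X φ)        = ST T V ρ (𝐒 w) φ

data Boxed : LTL → Set where
  atom : ∀ i → Boxed (atom i)
  G    : ∀ {φ} → Boxed φ → Boxed (G φ)
  Ĝ    : ∀ {s s' p φ} → Boxed φ → Boxed (Ĝ s s' p φ)
  X    : ∀ {φ} → Boxed φ → Boxed (X φ)

data Positive : LTL → Set where
  atom : ∀ i → Positive (atom i)
  ⊥'   : Positive ⊥'
  ⊤'   : Positive ⊤'
  _∧'_ : ∀ {φ ψ} → Positive φ → Positive ψ → Positive (φ ∧' ψ)
  _∨'_ : ∀ {φ ψ} → Positive φ → Positive ψ → Positive (φ ∨' ψ)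
  G    : ∀ {φ} → Positive φ → Positive (G φ)
  F    : ∀ {x φ} → Positive φ → Positive (F x φ)
  Ĝ    : ∀ {s s' p φ} → Positive φ → Positive (Ĝ s s' p φ)
  X    : ∀ {φ} → Positive φ → Positive (X φ)

data Negative : LTL → Set where
  ¬'_ : ∀ {φ} → Positive φ → Negative (¬' φ)
  Ĝ   : ∀ {s s' p N} → Negative N → Negative (Ĝ s s' p N)

data Untied : LTL → Set where
  boxed : ∀ {A} → Boxed A → Untied A
  neg   : ∀ {N} → Negative N → Untied N
  _∧'_  : ∀ {φ ψ} → Untied φ → Untied ψ → Untied (φ ∧' ψ)
  F     : ∀ {x φ} → Untied φ → Untied (F x φ)

data Sahlqvist : LTL → Set where
  ¬'_  : ∀ {E} → Untied E → Sahlqvist (¬' E)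
  _∧'_ : ∀ {φ ψ} → Sahlqvist φ → Sahlqvist ψ → Sahlqvist (φ ∧' ψ)

data FO : Set where
  _⩽ᶠ_ : Term → Term → FO
  _<ᶠ_ : Term → Term → FO
  _≐ᶠ_ : Term → Term → FO
  ⊥ᶠ   : FO
  ⊤ᶠ   : FO
  ¬ᶠ_  : FO → FO
  _∧ᶠ_ : FO → FO → FO
  _∨ᶠ_ : FO → FO → FO
  _⇒ᶠ_ : FO → FO → FO
  ∀ᶠ   : Var → FO → FO
  ∃ᶠ   : Var → FO → FO

FOSat : (T : TS) → Env T → FO → Set
FOSat T ρ (s ⩽ᶠ t) = ⟦ s ⟧ₜ ρ ⩽ ⟦ t ⟧ₜ ρ
FOSat T ρ (s <ᶠ t) = ⟦ s ⟧ₜ ρ ⋖ ⟦ t ⟧ₜ ρ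
FOSat T ρ (s ≐ᶠ t) = ⟦ s ⟧ₜ ρ ≈ₚ ⟦ t ⟧ₜ ρ
FOSat T ρ ⊥ᶠ       = ⊥
FOSat T ρ ⊤ᶠ       = ⊤
FOSat T ρ (¬ᶠ α)   = ¬ FOSat T ρ α
FOSat T ρ (α ∧ᶠ β) = FOSat T ρ α × FOSat T ρ β
FOSat T ρ (α ∨ᶠ β) = FOSat T ρ α ⊎ FOSat T ρ β
FOSat T ρ (α ⇒ᶠ β) = FOSat T ρ α → FOSat T ρ β
FOSat T ρ (∀ᶠ x α) = ∀ v → FOSat T (ρ [ x ↦ v ]) α
FOSat T ρ (∃ᶠ x α) = ∃ λ v → FOSat T (ρ [ x ↦ v ]) α

-- A Sahlqvist formula is a conjunction of negated untied formulas E, so it suffices to handle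
-- ∀V ¬E for one E. Pulling the F-quantifiers of E to the front, E holds under V iff for some
-- choice of witness paths all its boxed and all its negative conjuncts hold. A boxed conjunct
-- holds iff V contains its minimal valuation, which is first-order definable (a chain of ⩽ and <
-- steps ending in an equality of paths), while negative conjuncts are antitone in V. Hence ∀V ¬E
-- holds iff for all witnesses the negative conjuncts fail under the union of these minimal
-- valuations, and substituting the first-order definition of that valuation for the atoms in the
-- standard translation of the negative conjuncts gives the correspondent. The bound variables of
-- the first-order formula are taken above every variable of φ and above w, and the variables
-- bound by F are renamed accordingly.
module Submission where

open import Defs
open import Data.Nat using (ℕ; zero; suc; _+_; _⊔_; _≤_; _<_; _≟_; s≤s; z<s)
open import Data.Nat.Properties
open import Data.Product using (Σ; ∃; _×_; _,_; proj₁; proj₂)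
open import Data.Product.Function.NonDependent.Propositional using (_×-⇔_)
open import Data.Sum using (inj₁; inj₂)
open import Data.Sum.Function.Propositional using (_⊎-⇔_)
open import Data.Empty using (⊥-elim)
open import Data.Unit using (⊤; tt)
open import Data.List using (List; []; _∷_; [_]; _++_)
open import Data.List.Relation.Unary.All as All using (All; []; _∷_)
import Data.List.Relation.Unary.All.Properties as All
open import Data.List.Relation.Unary.Any as Any using (Any)
open import Data.List.Membership.Propositional using (lose)
open import Function using (_∘_; id)
open import Function.Bundles using (_⇔_; mk⇔; Equivalence)
open import Function.Construct.Identity using (⇔-id)
open import Function.Construct.Composition using (_⇔-∘_)
open import Function.Related.TypeIsomorphisms using (→-cong-⇔; ¬-cong-⇔)
open import Relation.Nullary using (¬_; yes; no)
open import Relation.Binary.PropositionalEquality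
  using (_≡_; refl; sym; trans; cong; subst; subst₂)

∀-cong-⇔ : ∀ {a b c} {I : Set a} {A : I → Set b} {B : I → Set c} →
           (∀ i → A i ⇔ B i) → (∀ i → A i) ⇔ (∀ i → B i)
∀-cong-⇔ A⇔B = mk⇔ (λ f i → Equivalence.to (A⇔B i) (f i)) (λ g i → Equivalence.from (A⇔B i) (g i))

∃-cong-⇔ : ∀ {a b c} {I : Set a} {A : I → Set b} {B : I → Set c} →
           (∀ i → A i ⇔ B i) → ∃ A ⇔ ∃ B
∃-cong-⇔ A⇔B = mk⇔ (λ (i , a) → i , Equivalence.to (A⇔B i) a) (λ (i , b) → i , Equivalence.from (A⇔B i) b)

subst-⇔ : ∀ {a r} {A : Set a} (P : A → Set r) {x x'} → x ≡ x' → P x ⇔ P x'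
subst-⇔ P refl = ⇔-id _

subst₂-⇔ : ∀ {a r} {A : Set a} (R : A → A → Set r) {x x' y y'} → x ≡ x' → y ≡ y' → R x y ⇔ R x' y'
subst₂-⇔ R refl refl = ⇔-id _

TermBelow : ℕ → Term → Set
TermBelow n (var y) = y < n
TermBelow n (S t)   = TermBelow n t

VarsBelow : ℕ → LTL → Set
VarsBelow n (atom i)     = ⊤
VarsBelow n ⊥'           = ⊤
VarsBelow n ⊤'           = ⊤
VarsBelow n (¬' φ)       = VarsBelow n φ
VarsBelow n (φ ∧' ψ)     = VarsBelow n φ × VarsBelow n ψ
VarsBelow n (φ ∨' ψ)     = VarsBelow n φ × VarsBelow n ψ
VarsBelow n (G φ)        = VarsBelow n φ
VarsBelow n (F x φ)      = x < n × VarsBelow n φ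
VarsBelow n (Ĝ s s' _ φ) = TermBelow n s × TermBelow n s' × VarsBelow n φ
VarsBelow n (X φ)        = VarsBelow n φ

TermBelow-mono : ∀ t {n m} → n ≤ m → TermBelow n t → TermBelow m t
TermBelow-mono (var y) n≤m y<n = <-≤-trans y<n n≤m
TermBelow-mono (S t)   n≤m t<n = TermBelow-mono t n≤m t<n

maxVarᵗ : Term → ℕ
maxVarᵗ (var y) = y
maxVarᵗ (S t)   = maxVarᵗ t

maxVar : LTL → ℕ
maxVar (atom i)     = 0
maxVar ⊥'           = 0
maxVar ⊤'           = 0
maxVar (¬' φ)       = maxVar φ
maxVar (φ ∧' ψ)     = maxVar φ ⊔ maxVar ψ
maxVar (φ ∨' ψ)     = maxVar φ ⊔ maxVar ψ
maxVar (G φ)        = maxVar φ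
maxVar (F x φ)      = x ⊔ maxVar φ
maxVar (Ĝ s s' _ φ) = maxVarᵗ s ⊔ maxVarᵗ s' ⊔ maxVar φ
maxVar (X φ)        = maxVar φ

TermBelow-maxVarᵗ : ∀ t {n} → maxVarᵗ t < n → TermBelow n t
TermBelow-maxVarᵗ (var y) y<n = y<n
TermBelow-maxVarᵗ (S t)   t<n = TermBelow-maxVarᵗ t t<n

VarsBelow-maxVar : ∀ φ {n} → maxVar φ < n → VarsBelow n φ
VarsBelow-maxVar (atom i)     _ = tt
VarsBelow-maxVar ⊥'           _ = tt
VarsBelow-maxVar ⊤'           _ = tt
VarsBelow-maxVar (¬' φ)       h = VarsBelow-maxVar φ h
VarsBelow-maxVar (φ ∧' ψ)     h = VarsBelow-maxVar φ (m⊔n<o⇒m<o _ _ h) , VarsBelow-maxVar ψ (m⊔n<o⇒n<o _ _ h)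
VarsBelow-maxVar (φ ∨' ψ)     h = VarsBelow-maxVar φ (m⊔n<o⇒m<o _ _ h) , VarsBelow-maxVar ψ (m⊔n<o⇒n<o _ _ h)
VarsBelow-maxVar (G φ)        h = VarsBelow-maxVar φ h
VarsBelow-maxVar (F x φ)      h = m⊔n<o⇒m<o _ _ h , VarsBelow-maxVar φ (m⊔n<o⇒n<o _ _ h)
VarsBelow-maxVar (Ĝ s s' _ φ) h =
  TermBelow-maxVarᵗ s (m⊔n<o⇒m<o _ _ terms<n) ,
  TermBelow-maxVarᵗ s' (m⊔n<o⇒n<o _ _ terms<n) ,
  VarsBelow-maxVar φ (m⊔n<o⇒n<o _ _ h)
  where terms<n = m⊔n<o⇒m<o (maxVarᵗ s ⊔ maxVarᵗ s') _ h
VarsBelow-maxVar (X φ)        h = VarsBelow-maxVar φ h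

rename : (Var → Var) → Term → Term
rename σ (var y) = var (σ y)
rename σ (S t)   = S (rename σ t)

rebind : (Var → Var) → Var → Var → Var → Var
rebind σ x c y with y ≟ x
... | yes _ = c
... | no  _ = σ y

private variable
  T : TS
  n m c : ℕ
  x y : Var
  σ : Var → Var
  ρ ρ' ρ'' ρL ρF : Env T
  v w z : Path T
  p t : Term
  V V' : Val T

record Agree {T : TS} (n : ℕ) (ρ ρ' : Env T) : Set where
  constructor agreeing
  field agrees : ∀ {y} → y < n → ρ y ≡ ρ' y
open Agree

Agree-refl : Agree n ρ ρ
Agree-refl = agreeing λ _ → refl

Agree-sym : Agree n ρ ρ' → Agree n ρ' ρ
Agree-sym a = agreeing λ h → sym (agrees a h)

Agree-trans : Agree n ρ ρ' → Agree n ρ' ρ'' → Agree n ρ ρ''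
Agree-trans a b = agreeing λ h → trans (agrees a h) (agrees b h)

Agree-mono : n ≤ m → Agree m ρ ρ' → Agree n ρ ρ'
Agree-mono n≤m a = agreeing λ h → agrees a (<-≤-trans h n≤m)

update-≡ : (ρ : Env T) (x : Var) (v : Path T) → (ρ [ x ↦ v ]) x ≡ v
update-≡ ρ x v with x ≟ x
... | yes _ = refl
... | no x≢x = ⊥-elim (x≢x refl)

Agree-update-fresh : Agree c ρ (ρ [ c ↦ v ])
Agree-update-fresh {c = c} .agrees {y} y<c with y ≟ c
... | yes refl = ⊥-elim (<-irrefl refl y<c)
... | no _ = refl

Agree-update : Agree n ρ ρ' → Agree n (ρ [ x ↦ v ]) (ρ' [ x ↦ v ])
Agree-update {x = x} a .agrees {y} h with y ≟ x
... | yes _ = refl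
... | no _ = agrees a h

Agree-update-extend : Agree c ρ ρ' → Agree (suc c) (ρ [ c ↦ ρ' c ]) ρ'
Agree-update-extend {c = c} a .agrees {y} h with y ≟ c
... | yes refl = refl
... | no y≢c = agrees a (≤∧≢⇒< (≤-pred h) y≢c)

⟦⟧-agree : ∀ t → TermBelow n t → Agree n ρ ρ' → ⟦ t ⟧ₜ ρ ≡ ⟦ t ⟧ₜ ρ'
⟦⟧-agree (var y) y<n a = agrees a y<n
⟦⟧-agree (S t)   t<n a = cong 𝐒 (⟦⟧-agree t t<n a)

⟦rename⟧ : ∀ t → ⟦ rename σ t ⟧ₜ ρ ≡ ⟦ t ⟧ₜ (ρ ∘ σ)
⟦rename⟧ (var y) = refl
⟦rename⟧ (S t)   = cong 𝐒 (⟦rename⟧ t)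

module _ (N : ℕ) where

  Bounded : (Var → Var) → ℕ → Set
  Bounded σ c = ∀ {y} → y < N → σ y < c

  Bounded-mono : c ≤ m → Bounded σ c → Bounded σ m
  Bounded-mono c≤m b h = <-≤-trans (b h) c≤m

  Bounded-rebind : Bounded σ c → Bounded (rebind σ x c) (suc c)
  Bounded-rebind {c = c} {x = x} b {y} h with y ≟ x
  ... | yes _ = n<1+n c
  ... | no  _ = m<n⇒m<1+n (b h)

  Agree-∘ : Bounded σ c → Agree c ρ ρ' → Agree N (ρ ∘ σ) (ρ' ∘ σ)
  Agree-∘ b a = agreeing λ h → agrees a (b h)

  Agree-rebind : Agree N ρL (ρ ∘ σ) → ρ c ≡ v → Agree N (ρL [ x ↦ v ]) (ρ ∘ rebind σ x c)
  Agree-rebind {x = x} a ρc≡v .agrees {y} h with y ≟ x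
  ... | yes _ = sym ρc≡v
  ... | no  _ = agrees a h

  ST-agree : ∀ φ → VarsBelow N φ → Agree N ρ ρ' → ST T V ρ w φ → ST T V ρ' w φ
  ST-agree (atom i)     _              _ h = h
  ST-agree ⊤'           _              _ h = h
  ST-agree (¬' φ)       φ<N            a h = λ h' → h (ST-agree φ φ<N (Agree-sym a) h')
  ST-agree (φ ∧' ψ)     (φ<N , ψ<N)    a (hφ , hψ) = ST-agree φ φ<N a hφ , ST-agree ψ ψ<N a hψ
  ST-agree (φ ∨' ψ)     (φ<N , _)      a (inj₁ h) = inj₁ (ST-agree φ φ<N a h)
  ST-agree (φ ∨' ψ)     (_ , ψ<N)      a (inj₂ h) = inj₂ (ST-agree ψ ψ<N a h)
  ST-agree (G φ)        φ<N            a h = λ v w⩽v → ST-agree φ φ<N a (h v w⩽v)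
  ST-agree (F x φ)      (_ , φ<N)      a (v , w⩽v , h) = v , w⩽v , ST-agree φ φ<N (Agree-update a) h
  ST-agree (Ĝ s s' _ φ) (s<N , s'<N , φ<N) a h = λ v s⩽v v<s' →
    ST-agree φ φ<N a (h v (subst (_⩽ v) (sym (⟦⟧-agree s s<N a)) s⩽v)
                          (subst (v ⋖_) (sym (⟦⟧-agree s' s'<N a)) v<s'))
  ST-agree (X φ)        φ<N            a h = ST-agree φ φ<N a h

  ST-transport : ∀ φ → VarsBelow N φ → Agree N ρ ρ' → w ≡ v → ST T V ρ w φ → ST T V ρ' v φ
  ST-transport φ φ<N a refl = ST-agree φ φ<N a

_⊆ᵛ_ : Val T → Val T → Set
V ⊆ᵛ V' = ∀ {i z} → V i z → V' i z

positive-mono : ∀ {φ} → Positive φ → V ⊆ᵛ V' → ST T V ρ w φ → ST T V' ρ w φ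
positive-mono (atom i) V⊆V' h = V⊆V' h
positive-mono ⊤'       V⊆V' h = h
positive-mono (P ∧' Q) V⊆V' (hP , hQ) = positive-mono P V⊆V' hP , positive-mono Q V⊆V' hQ
positive-mono (P ∨' Q) V⊆V' (inj₁ h) = inj₁ (positive-mono P V⊆V' h)
positive-mono (P ∨' Q) V⊆V' (inj₂ h) = inj₂ (positive-mono Q V⊆V' h)
positive-mono (G P)    V⊆V' h = λ v w⩽v → positive-mono P V⊆V' (h v w⩽v)
positive-mono (F P)    V⊆V' (v , w⩽v , h) = v , w⩽v , positive-mono P V⊆V' h
positive-mono (Ĝ P)    V⊆V' h = λ v s⩽v v<s' → positive-mono P V⊆V' (h v s⩽v v<s')
positive-mono (X P)    V⊆V' h = positive-mono P V⊆V' h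

negative-anti : ∀ {φ} → Negative φ → V' ⊆ᵛ V → ST T V ρ w φ → ST T V' ρ w φ
negative-anti (¬' P)  V'⊆V h = λ h' → h (positive-mono P V'⊆V h')
negative-anti (Ĝ Nφ) V'⊆V h = λ v s⩽v v<s' → negative-anti Nφ V'⊆V (h v s⩽v v<s')

minimal : ∀ {A} → Boxed A → Env T → Path T → Val T
minimal (atom j)       ρ w i z = j ≡ i × w ≈ₚ z
minimal (G b)          ρ w i z = ∃ λ v → w ⩽ v × minimal b ρ v i z
minimal (Ĝ {s} {s'} b) ρ w i z = ∃ λ v → ⟦ s ⟧ₜ ρ ⩽ v × v ⋖ ⟦ s' ⟧ₜ ρ × minimal b ρ v i z
minimal (X b)          ρ w i z = minimal b ρ (𝐒 w) i z

minimal-resp : ∀ {A} (b : Boxed A) {i z z'} → z ≈ₚ z' → minimal b ρ w i z → minimal b ρ w i z'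
minimal-resp (atom j) z≈z' (j≡i , w≈z) = j≡i , λ k → trans (w≈z k) (z≈z' k)
minimal-resp (G b)    z≈z' (v , w⩽v , m) = v , w⩽v , minimal-resp b z≈z' m
minimal-resp (Ĝ b)    z≈z' (v , s⩽v , v<s' , m) = v , s⩽v , v<s' , minimal-resp b z≈z' m
minimal-resp (X b)    z≈z' m = minimal-resp b z≈z' m

ST-boxed-intro : ∀ {A} (b : Boxed A) → minimal b ρ w ⊆ᵛ V → ST T V ρ w A
ST-boxed-intro (atom j) m⊆V = m⊆V (refl , λ _ → refl)
ST-boxed-intro (G b)    m⊆V = λ v w⩽v → ST-boxed-intro b (λ m → m⊆V (v , w⩽v , m))
ST-boxed-intro (Ĝ b)    m⊆V = λ v s⩽v v<s' → ST-boxed-intro b (λ m → m⊆V (v , s⩽v , v<s' , m))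
ST-boxed-intro (X b)    m⊆V = ST-boxed-intro b m⊆V

minimal-⊆ : ∀ {A} (b : Boxed A) → RespVal T V → ST T V ρ w A → minimal b ρ w ⊆ᵛ V
minimal-⊆ {w = w} (atom j) resp h (refl , w≈z) = resp j w _ w≈z h
minimal-⊆ (G b) resp h (v , w⩽v , m) = minimal-⊆ b resp (h v w⩽v) m
minimal-⊆ (Ĝ b) resp h (v , s⩽v , v<s' , m) = minimal-⊆ b resp (h v s⩽v v<s') m
minimal-⊆ (X b) resp h m = minimal-⊆ b resp h m

-- M i q c is a first-order definition of "atom i holds at q" whose bound variables are all ≥ c.
Subst : Set
Subst = ℕ → Term → ℕ → FO

translate : Subst → (Var → Var) → ℕ → Term → LTL → FO
translate M σ c p (atom i)     = M i p c
translate M σ c p ⊥'           = ⊥ᶠ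
translate M σ c p ⊤'           = ⊤ᶠ
translate M σ c p (¬' φ)       = ¬ᶠ translate M σ c p φ
translate M σ c p (φ ∧' ψ)     = translate M σ c p φ ∧ᶠ translate M σ c p ψ
translate M σ c p (φ ∨' ψ)     = translate M σ c p φ ∨ᶠ translate M σ c p ψ
translate M σ c p (G φ)        = ∀ᶠ c ((p ⩽ᶠ var c) ⇒ᶠ translate M σ (suc c) (var c) φ)
translate M σ c p (F x φ)      = ∃ᶠ c ((p ⩽ᶠ var c) ∧ᶠ translate M (rebind σ x c) (suc c) (var c) φ)
translate M σ c p (Ĝ s s' _ φ) =
  ∀ᶠ c ((rename σ s ⩽ᶠ var c) ⇒ᶠ ((var c <ᶠ rename σ s') ⇒ᶠ translate M σ (suc c) (var c) φ))
translate M σ c p (X φ)        = translate M σ c (S p) φ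

minimalᶠ : ∀ {A} → Boxed A → (Var → Var) → Term → Subst
minimalᶠ (atom j) σ p i q c with j ≟ i
... | yes _ = p ≐ᶠ q
... | no  _ = ⊥ᶠ
minimalᶠ (G b)          σ p i q c = ∃ᶠ c ((p ⩽ᶠ var c) ∧ᶠ minimalᶠ b σ (var c) i q (suc c))
minimalᶠ (Ĝ {s} {s'} b) σ p i q c =
  ∃ᶠ c ((rename σ s ⩽ᶠ var c) ∧ᶠ ((var c <ᶠ rename σ s') ∧ᶠ minimalᶠ b σ (var c) i q (suc c)))
minimalᶠ (X b)          σ p i q c = minimalᶠ b σ (S p) i q c

record Defines {T : TS} (c : ℕ) (ρ : Env T) (M : Subst) (V : Val T) : Set where
  field
    defines : ∀ {ρ' c' i q} → c ≤ c' → Agree c ρ ρ' → TermBelow c' q →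
              FOSat T ρ' (M i q c') ⇔ V i (⟦ q ⟧ₜ ρ')
open Defines

Defines-step : ∀ {M} → Defines c ρ M V → Defines (suc c) (ρ [ c ↦ v ]) M V
Defines-step M≡V .defines c<c' a =
  defines M≡V (<⇒≤ c<c') (Agree-trans Agree-update-fresh (Agree-mono (n≤1+n _) a))

⟦⟧-fresh : ∀ t → TermBelow c t → ⟦ t ⟧ₜ (ρ [ c ↦ v ]) ≡ ⟦ t ⟧ₜ ρ
⟦⟧-fresh t t<c = sym (⟦⟧-agree t t<c Agree-update-fresh)

module _ (N : ℕ) where

  -- The first-order side keeps LTL variable y in variable σ y, has not used the variables ≥ c
  -- yet, and names the current path w by the term p.
  record Simulation {T : TS} (σ : Var → Var) (c : ℕ) (p : Term) (ρF ρL : Env T) (w : Path T) : Set where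
    field
      bounded : Bounded N σ c
      scoped  : TermBelow c p
      env     : Agree N ρL (ρF ∘ σ)
      point   : ⟦ p ⟧ₜ ρF ≡ w
  open Simulation

  Simulation-X : Simulation σ c p ρF ρL w → Simulation σ c (S p) ρF ρL (𝐒 w)
  Simulation-X sim = record
    { bounded = bounded sim ; scoped = scoped sim ; env = env sim ; point = cong 𝐒 (point sim) }

  Simulation-step : Simulation σ c p ρF ρL w → Simulation σ (suc c) (var c) (ρF [ c ↦ v ]) ρL v
  Simulation-step {c = c} {ρF = ρF} {v = v} sim = record
    { bounded = Bounded-mono N (n≤1+n _) (bounded sim)
    ; scoped  = n<1+n _
    ; env     = Agree-trans (env sim) (Agree-∘ N (bounded sim) Agree-update-fresh)
    ; point   = update-≡ ρF c v
    }

  Simulation-bind : Simulation σ c p ρF ρL w →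
                    Simulation (rebind σ x c) (suc c) (var c) (ρF [ c ↦ v ]) (ρL [ x ↦ v ]) v
  Simulation-bind {σ = σ} {c = c} {ρF = ρF} {x = x} {v = v} sim = record
    { bounded = Bounded-rebind N (bounded sim)
    ; scoped  = n<1+n _
    ; env     = Agree-rebind N {ρ = ρF [ c ↦ v ]} {σ = σ} {x = x}
                  (Agree-trans (env sim) (Agree-∘ N (bounded sim) Agree-update-fresh)) (update-≡ ρF c v)
    ; point   = update-≡ ρF c v
    }

  rename-≡ : ∀ s → Simulation σ c p ρF ρL w → TermBelow N s → ⟦ rename σ s ⟧ₜ ρF ≡ ⟦ s ⟧ₜ ρL
  rename-≡ s sim s<N = trans (⟦rename⟧ s) (sym (⟦⟧-agree s s<N (env sim)))

  future-⇔ : Simulation σ c p ρF ρL w → FOSat T (ρF [ c ↦ v ]) (p ⩽ᶠ var c) ⇔ w ⩽ v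
  future-⇔ {c = c} {p = p} {ρF = ρF} {v = v} sim =
    subst₂-⇔ _⩽_ (trans (⟦⟧-fresh p (scoped sim)) (point sim)) (update-≡ ρF c v)

  translate-correct : ∀ {M} φ → VarsBelow N φ → Simulation σ c p ρF ρL w → Defines c ρF M V →
                      FOSat T ρF (translate M σ c p φ) ⇔ ST T V ρL w φ
  translate-correct {ρF = ρF} {V = V} (atom i) _ sim M≡V =
    subst-⇔ (V i) (point sim) ⇔-∘ defines M≡V {ρF} ≤-refl Agree-refl (scoped sim)
  translate-correct ⊥'        _           _   _   = ⇔-id _
  translate-correct ⊤'        _           _   _   = ⇔-id _
  translate-correct (¬' φ)    φ<N         sim M≡V = ¬-cong-⇔ (translate-correct φ φ<N sim M≡V)
  translate-correct (φ ∧' ψ)  (φ<N , ψ<N) sim M≡V =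
    translate-correct φ φ<N sim M≡V ×-⇔ translate-correct ψ ψ<N sim M≡V
  translate-correct (φ ∨' ψ)  (φ<N , ψ<N) sim M≡V =
    translate-correct φ φ<N sim M≡V ⊎-⇔ translate-correct ψ ψ<N sim M≡V
  translate-correct (G φ)     φ<N         sim M≡V = ∀-cong-⇔ λ v →
    →-cong-⇔ (future-⇔ sim) (translate-correct φ φ<N (Simulation-step sim) (Defines-step M≡V))
  translate-correct (F x φ)   (_ , φ<N)   sim M≡V = ∃-cong-⇔ λ v →
    future-⇔ sim ×-⇔ translate-correct φ φ<N (Simulation-bind sim) (Defines-step M≡V)
  translate-correct (Ĝ s s' _ φ) (s<N , s'<N , φ<N) sim M≡V = ∀-cong-⇔ λ v →
    let sim' = Simulation-step sim in
    →-cong-⇔ (subst₂-⇔ _⩽_ (rename-≡ s sim' s<N) (point sim'))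
      (→-cong-⇔ (subst₂-⇔ _⋖_ (point sim') (rename-≡ s' sim' s'<N))
        (translate-correct φ φ<N sim' (Defines-step M≡V)))
  translate-correct (X φ)     φ<N         sim M≡V = translate-correct φ φ<N (Simulation-X sim) M≡V

  minimalᶠ-correct : ∀ {A} (b : Boxed A) {i q z} → VarsBelow N A → Simulation σ c p ρF ρL w →
                     TermBelow c q → ⟦ q ⟧ₜ ρF ≡ z →
                     FOSat T ρF (minimalᶠ b σ p i q c) ⇔ minimal b ρL w i z
  minimalᶠ-correct (atom j) {i} _ sim q<c q≡z with j ≟ i
  ... | yes refl = mk⇔ (refl ,_) proj₂ ⇔-∘ subst₂-⇔ _≈ₚ_ (point sim) q≡z
  ... | no  j≢i  = mk⇔ (λ ()) (λ (j≡i , _) → j≢i j≡i)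
  minimalᶠ-correct {c = c} (G b) {q = q} A<N sim q<c q≡z = ∃-cong-⇔ λ v →
    future-⇔ sim ×-⇔
    minimalᶠ-correct b A<N (Simulation-step sim) (TermBelow-mono q (n≤1+n c) q<c)
      (trans (⟦⟧-fresh q q<c) q≡z)
  minimalᶠ-correct {c = c} (Ĝ {s} {s'} b) {q = q} (s<N , s'<N , A<N) sim q<c q≡z = ∃-cong-⇔ λ v →
    let sim' = Simulation-step sim in
    subst₂-⇔ _⩽_ (rename-≡ s sim' s<N) (point sim') ×-⇔
    (subst₂-⇔ _⋖_ (point sim') (rename-≡ s' sim' s'<N) ×-⇔
     minimalᶠ-correct b A<N sim' (TermBelow-mono q (n≤1+n c) q<c) (trans (⟦⟧-fresh q q<c) q≡z))
  minimalᶠ-correct (X b) A<N sim q<c q≡z = minimalᶠ-correct b A<N (Simulation-X sim) q<c q≡z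

⋀ᶠ : {A : Set} → (A → FO) → List A → FO
⋀ᶠ f []       = ⊤ᶠ
⋀ᶠ f (x ∷ xs) = f x ∧ᶠ ⋀ᶠ f xs

⋁ᶠ : {A : Set} → (A → FO) → List A → FO
⋁ᶠ f []       = ⊥ᶠ
⋁ᶠ f (x ∷ xs) = f x ∨ᶠ ⋁ᶠ f xs

module _ {A : Set} {P Q R : A → Set} where

  All-cong-⇔ : ∀ {xs} → All R xs → (∀ {x} → R x → P x ⇔ Q x) → All P xs ⇔ All Q xs
  All-cong-⇔ []       _   = mk⇔ (λ _ → []) (λ _ → [])
  All-cong-⇔ (r ∷ rs) P⇔Q =
    mk⇔ (λ (q , qs) → q ∷ qs) All.uncons ⇔-∘
    ((P⇔Q r ×-⇔ All-cong-⇔ rs P⇔Q) ⇔-∘ mk⇔ All.uncons (λ (p , ps) → p ∷ ps))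

  Any-cong-⇔ : ∀ {xs} → All R xs → (∀ {x} → R x → P x ⇔ Q x) → Any P xs ⇔ Any Q xs
  Any-cong-⇔ []       _   = mk⇔ (λ ()) (λ ())
  Any-cong-⇔ (r ∷ rs) P⇔Q =
    mk⇔ Any.fromSum Any.toSum ⇔-∘
    ((P⇔Q r ⊎-⇔ Any-cong-⇔ rs P⇔Q) ⇔-∘ mk⇔ Any.toSum Any.fromSum)

⋀ᶠ-All : ∀ {A : Set} {f : A → FO} xs → FOSat T ρ (⋀ᶠ f xs) ⇔ All (FOSat T ρ ∘ f) xs
⋀ᶠ-All []       = mk⇔ (λ _ → []) (λ _ → tt)
⋀ᶠ-All (x ∷ xs) = mk⇔ (λ (h , hs) → h ∷ hs) All.uncons ⇔-∘ (⇔-id _ ×-⇔ ⋀ᶠ-All xs)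

⋁ᶠ-Any : ∀ {A : Set} {f : A → FO} xs → FOSat T ρ (⋁ᶠ f xs) ⇔ Any (FOSat T ρ ∘ f) xs
⋁ᶠ-Any []       = mk⇔ (λ ()) (λ ())
⋁ᶠ-Any (x ∷ xs) = mk⇔ Any.fromSum Any.toSum ⇔-∘ (⇔-id _ ⊎-⇔ ⋁ᶠ-Any xs)

∀ᶠ-range : ℕ → ℕ → FO → FO
∀ᶠ-range c zero    β = β
∀ᶠ-range c (suc n) β = ∀ᶠ c (∀ᶠ-range (suc c) n β)

∀ᶠ-range-intro : ∀ c n {β} → (∀ ρ' → Agree c ρ ρ' → FOSat T ρ' β) → FOSat T ρ (∀ᶠ-range c n β)
∀ᶠ-range-intro c zero    h = h _ Agree-refl
∀ᶠ-range-intro c (suc n) h = λ v →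
  ∀ᶠ-range-intro (suc c) n λ ρ' a → h ρ' (Agree-trans Agree-update-fresh (Agree-mono (n≤1+n c) a))

∀ᶠ-range-elim : ∀ c n {β} → FOSat T ρ (∀ᶠ-range c n β) → Agree c ρ ρ' →
                Σ (Env T) λ ρ'' → Agree (c + n) ρ' ρ'' × FOSat T ρ'' β
∀ᶠ-range-elim {ρ = ρ} c zero h a = ρ , Agree-mono (≤-reflexive (+-identityʳ c)) (Agree-sym a) , h
∀ᶠ-range-elim {ρ' = ρ'} c (suc n) h a
  with ∀ᶠ-range-elim (suc c) n (h (ρ' c)) (Agree-update-extend a)
... | ρ'' , a'' , h'' = ρ'' , Agree-mono (≤-reflexive (+-suc c n)) a'' , h''

record Conjunct (P : LTL → Set) : Set where
  constructor conjunct
  field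
    variables : Var → Var
    site      : Term
    formula   : LTL
    shape     : P formula

-- An untied formula with its F-quantifiers pulled to the front: the witness of each F is kept in
-- its own variable c, and (p , c) records that it lies in the future of p.
record Decomposition : Set where
  constructor decomposition
  field
    witnesses : List (Term × Var)
    boxes     : List (Conjunct Boxed)
    negatives : List (Conjunct Negative)
open Decomposition

_⊕_ : Decomposition → Decomposition → Decomposition
d₁ ⊕ d₂ = decomposition (witnesses d₁ ++ witnesses d₂) (boxes d₁ ++ boxes d₂) (negatives d₁ ++ negatives d₂)

slots : ∀ {E} → Untied E → ℕ
slots (boxed _)  = 0
slots (neg _)    = 0
slots (u₁ ∧' u₂) = slots u₁ + slots u₂
slots (F u)      = suc (slots u)

decompose : ∀ {E} → Untied E → (Var → Var) → ℕ → Term → Decomposition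
decompose (boxed b)  σ c p = decomposition [] [ conjunct σ p _ b ] []
decompose (neg n)    σ c p = decomposition [] [] [ conjunct σ p _ n ]
decompose (u₁ ∧' u₂) σ c p = decompose u₁ σ c p ⊕ decompose u₂ σ (c + slots u₁) p
decompose (F {x} u)  σ c p = decomposition ((p , c) ∷ witnesses d) (boxes d) (negatives d)
  where d = decompose u (rebind σ x c) (suc c) (var c)

reachᶠ : Term × Var → FO
reachᶠ (p , c) = p ⩽ᶠ var c

witnessesᶠ : Decomposition → FO
witnessesᶠ d = ⋀ᶠ reachᶠ (witnesses d)

boxᶠ : Conjunct Boxed → Subst
boxᶠ (conjunct σ p _ b) = minimalᶠ b σ p

boxesᶠ : Decomposition → Subst
boxesᶠ d i q c = ⋁ᶠ (λ k → boxᶠ k i q c) (boxes d)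

negativeᶠ : Subst → ℕ → Conjunct Negative → FO
negativeᶠ M c (conjunct σ p φ _) = translate M σ c p φ

negativesᶠ : Subst → ℕ → Decomposition → FO
negativesᶠ M c d = ⋀ᶠ (negativeᶠ M c) (negatives d)

correspondentᵘ : ∀ {E} → Untied E → ℕ → Var → FO
correspondentᵘ u N w =
  ∀ᶠ-range N (slots u) (witnessesᶠ d ⇒ᶠ (¬ᶠ negativesᶠ (boxesᶠ d) (N + slots u) d))
  where d = decompose u id N (var w)

correspondent : ∀ {φ} → Sahlqvist φ → ℕ → Var → FO
correspondent (¬' u)     N w = correspondentᵘ u N w
correspondent (s₁ ∧' s₂) N w = correspondent s₁ N w ∧ᶠ correspondent s₂ N w

module _ {P : LTL → Set} where

  ConjunctHolds : Val T → Env T → Conjunct P → Set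
  ConjunctHolds {T} V ρ (conjunct σ p φ _) = ST T V (ρ ∘ σ) (⟦ p ⟧ₜ ρ) φ

Holds : Val T → Env T → Decomposition → Set
Holds {T} V ρ d = All (FOSat T ρ ∘ reachᶠ) (witnesses d) × All (ConjunctHolds V ρ) (boxes d)
                × All (ConjunctHolds V ρ) (negatives d)

Holds-⊕⁺ : ∀ {d₁ d₂} → Holds V ρ d₁ → Holds V ρ d₂ → Holds V ρ (d₁ ⊕ d₂)
Holds-⊕⁺ (ws₁ , bs₁ , ns₁) (ws₂ , bs₂ , ns₂) = All.++⁺ ws₁ ws₂ , All.++⁺ bs₁ bs₂ , All.++⁺ ns₁ ns₂

Holds-⊕⁻ : ∀ d₁ {d₂} → Holds V ρ (d₁ ⊕ d₂) → Holds V ρ d₁ × Holds V ρ d₂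
Holds-⊕⁻ d₁ (ws , bs , ns) =
  (All.++⁻ˡ (witnesses d₁) ws , All.++⁻ˡ (boxes d₁) bs , All.++⁻ˡ (negatives d₁) ns) ,
  (All.++⁻ʳ (witnesses d₁) ws , All.++⁻ʳ (boxes d₁) bs , All.++⁻ʳ (negatives d₁) ns)

minimalᶜ : Env T → Conjunct Boxed → Val T
minimalᶜ ρ (conjunct σ p _ b) = minimal b (ρ ∘ σ) (⟦ p ⟧ₜ ρ)

minimalOf : Env T → Decomposition → Val T
minimalOf ρ d i z = Any (λ k → minimalᶜ ρ k i z) (boxes d)

minimalOf-resp : ∀ d → RespVal T (minimalOf ρ d)
minimalOf-resp d i z z' z≈z' = Any.map λ { {conjunct _ _ _ b} → minimal-resp b z≈z' }

minimalOf-⊆ : ∀ d → RespVal T V → All (ConjunctHolds V ρ) (boxes d) → minimalOf ρ d ⊆ᵛ V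
minimalOf-⊆ d resp hs = All.lookupWith (λ { {conjunct _ _ _ b} h m → minimal-⊆ b resp h m }) hs

minimalOf-boxes : ∀ d → All (ConjunctHolds (minimalOf ρ d) ρ) (boxes d)
minimalOf-boxes d = All.tabulate λ { {conjunct _ _ _ b} k∈ → ST-boxed-intro b (lose k∈) }

negatives-anti : ∀ d → V' ⊆ᵛ V → All (ConjunctHolds V ρ) (negatives d) → All (ConjunctHolds V' ρ) (negatives d)
negatives-anti d V'⊆V = All.map λ { {conjunct _ _ _ n} → negative-anti n V'⊆V }

module _ (N : ℕ) where

  ConjunctScoped : ∀ {P} → ℕ → Conjunct P → Set
  ConjunctScoped D (conjunct σ p φ _) = Bounded N σ D × TermBelow D p × VarsBelow N φ

  WitnessScoped : ℕ → Term × Var → Set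
  WitnessScoped D (p , c) = TermBelow D p × c < D

  Scoped : ℕ → Decomposition → Set
  Scoped D d = All (WitnessScoped D) (witnesses d) × All (ConjunctScoped D) (boxes d)
             × All (ConjunctScoped D) (negatives d)

  Scoped-⊕ : ∀ {D d₁ d₂} → Scoped D d₁ → Scoped D d₂ → Scoped D (d₁ ⊕ d₂)
  Scoped-⊕ (ws₁ , bs₁ , ns₁) (ws₂ , bs₂ , ns₂) = All.++⁺ ws₁ ws₂ , All.++⁺ bs₁ bs₂ , All.++⁺ ns₁ ns₂

  decompose-scoped : ∀ {E D} (u : Untied E) → VarsBelow N E → Bounded N σ c → TermBelow c p →
                     c + slots u ≤ D → Scoped D (decompose u σ c p)
  decompose-scoped {c = c} {p = p} (boxed _) E<N b p<c c≤D =
    [] , (Bounded-mono N c≤D' b , TermBelow-mono p c≤D' p<c , E<N) ∷ [] , []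
    where c≤D' = ≤-trans (m≤m+n c 0) c≤D
  decompose-scoped {c = c} {p = p} (neg _) E<N b p<c c≤D =
    [] , [] , (Bounded-mono N c≤D' b , TermBelow-mono p c≤D' p<c , E<N) ∷ []
    where c≤D' = ≤-trans (m≤m+n c 0) c≤D
  decompose-scoped {c = c} {p = p} (u₁ ∧' u₂) (E₁<N , E₂<N) b p<c c+s≤D = Scoped-⊕
    (decompose-scoped u₁ E₁<N b p<c (≤-trans (+-monoʳ-≤ c (m≤m+n (slots u₁) (slots u₂))) c+s≤D))
    (decompose-scoped u₂ E₂<N (Bounded-mono N c≤c+s₁ b) (TermBelow-mono p c≤c+s₁ p<c)
      (≤-trans (≤-reflexive (+-assoc c (slots u₁) (slots u₂))) c+s≤D))
    where c≤c+s₁ = m≤m+n c (slots u₁)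
  decompose-scoped {c = c} {p = p} (F u) (_ , E<N) b p<c c+s≤D
    with decompose-scoped u E<N (Bounded-rebind N b) (n<1+n c)
           (≤-trans (≤-reflexive (sym (+-suc c (slots u)))) c+s≤D)
  ... | ws , bs , ns = (TermBelow-mono p (<⇒≤ c<D) p<c , c<D) ∷ ws , bs , ns
    where c<D = <-≤-trans (m<m+n c z<s) c+s≤D

  Holds-stable : ∀ {D} d → Scoped D d → Agree D ρ ρ' → Holds V ρ d → Holds V ρ' d
  Holds-stable {ρ = ρ} {ρ' = ρ'} {V = V} d (wsc , bsc , nsc) a (ws , bs , ns) =
    All.zipWith (λ {s} → reached s) (wsc , ws) ,
    All.zipWith (λ {k} → conjunct-holds k) (bsc , bs) ,
    All.zipWith (λ {k} → conjunct-holds k) (nsc , ns)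
    where
      reached : ∀ s → WitnessScoped _ s × FOSat _ ρ (reachᶠ s) → FOSat _ ρ' (reachᶠ s)
      reached (p , c) ((p<D , c<D) , h) = subst₂ _⩽_ (⟦⟧-agree p p<D a) (agrees a c<D) h
      conjunct-holds : ∀ {P} (k : Conjunct P) → ConjunctScoped _ k × ConjunctHolds V ρ k → ConjunctHolds V ρ' k
      conjunct-holds (conjunct σ p φ _) ((b , p<D , φ<N) , h) =
        ST-transport N φ φ<N (Agree-∘ N b a) (⟦⟧-agree p p<D a) h

  decompose-sound : ∀ {E} (u : Untied E) → VarsBelow N E → Holds V ρ (decompose u σ c p) →
                    ST T V (ρ ∘ σ) (⟦ p ⟧ₜ ρ) E
  decompose-sound (boxed _)  _ (_ , h ∷ [] , _) = h
  decompose-sound (neg _)    _ (_ , _ , h ∷ []) = h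
  decompose-sound {σ = σ} {c = c} {p = p} (u₁ ∧' u₂) (E₁<N , E₂<N) H
    with Holds-⊕⁻ (decompose u₁ σ c p) H
  ... | H₁ , H₂ = decompose-sound u₁ E₁<N H₁ , decompose-sound u₂ E₂<N H₂
  decompose-sound {ρ = ρ} {σ = σ} {c = c} (F {φ = E} u) (_ , E<N) (r ∷ ws , bs , ns) =
    ρ c , r , ST-agree N E E<N (Agree-sym (Agree-rebind N {ρ = ρ} {σ = σ} Agree-refl refl))
                (decompose-sound u E<N (ws , bs , ns))

  decompose-complete : ∀ {E} (u : Untied E) → VarsBelow N E → Bounded N σ c → TermBelow c p →
                       ST T V (ρ ∘ σ) (⟦ p ⟧ₜ ρ) E →
                       Σ (Env T) λ ρ' → Agree c ρ ρ' × Holds V ρ' (decompose u σ c p)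
  decompose-complete {ρ = ρ} (boxed _) _ _ _ h = ρ , Agree-refl , [] , h ∷ [] , []
  decompose-complete {ρ = ρ} (neg _)   _ _ _ h = ρ , Agree-refl , [] , [] , h ∷ []
  decompose-complete {c = c} {p = p} (_∧'_ {ψ = E₂} u₁ u₂) (E₁<N , E₂<N) b p<c (h₁ , h₂)
    with decompose-complete u₁ E₁<N b p<c h₁
  ... | ρ₁ , a₁ , H₁
    with decompose-complete u₂ E₂<N
           (Bounded-mono N (m≤m+n c (slots u₁)) b) (TermBelow-mono p (m≤m+n c (slots u₁)) p<c)
           (ST-transport N E₂ E₂<N (Agree-∘ N b a₁) (⟦⟧-agree p p<c a₁) h₂)
  ... | ρ₂ , a₂ , H₂ =
    ρ₂ , Agree-trans a₁ (Agree-mono c≤c+s₁ a₂) ,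
    Holds-⊕⁺ (Holds-stable (decompose u₁ _ c p) (decompose-scoped u₁ E₁<N b p<c ≤-refl) a₂ H₁) H₂
    where c≤c+s₁ = m≤m+n c (slots u₁)
  decompose-complete {σ = σ} {c = c} {p = p} {ρ = ρ} (F {x} {E} u) (_ , E<N) b p<c (v , p⩽v , h)
    with decompose-complete u E<N (Bounded-rebind N b) (n<1+n c)
           (ST-transport N E E<N (Agree-rebind N {ρ = ρ [ c ↦ v ]} (Agree-∘ N b Agree-update-fresh) ρ₁c≡v)
              (sym ρ₁c≡v) h)
    where ρ₁c≡v = update-≡ ρ c v
  ... | ρ₂ , a₂ , ws , bs , ns = ρ₂ , a , reached ∷ ws , bs , ns
    where
      a : Agree c ρ ρ₂
      a = Agree-trans Agree-update-fresh (Agree-mono (n≤1+n c) a₂)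
      reached : ⟦ p ⟧ₜ ρ₂ ⩽ ρ₂ c
      reached = subst₂ _⩽_ (⟦⟧-agree p p<c a) (trans (sym (update-≡ ρ c v)) (agrees a₂ (n<1+n c))) p⩽v

  conjunct-simulation : ∀ {P D c'} (k : Conjunct P) → ConjunctScoped D k → D ≤ c' → Agree D ρ ρ' →
                        Simulation N (Conjunct.variables k) c' (Conjunct.site k) ρ' (ρ ∘ Conjunct.variables k)
                                   (⟦ Conjunct.site k ⟧ₜ ρ)
  conjunct-simulation (conjunct σ p φ _) (b , p<D , _) D≤c' a = record
    { bounded = Bounded-mono N D≤c' b
    ; scoped  = TermBelow-mono p D≤c' p<D
    ; env     = Agree-∘ N b a
    ; point   = sym (⟦⟧-agree p p<D a)
    }

  boxesᶠ-defines : ∀ {D} d → Scoped D d → Defines D ρ (boxesᶠ d) (minimalOf ρ d)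
  boxesᶠ-defines {ρ = ρ} d (_ , bsc , _) .defines {ρ'} {i = i} {q} D≤c' a q<c' =
    Any-cong-⇔ bsc (λ {k} sc → boxᶠ-correct k sc) ⇔-∘ ⋁ᶠ-Any (boxes d)
    where
      boxᶠ-correct : ∀ k → ConjunctScoped _ k → FOSat _ ρ' (boxᶠ k i q _) ⇔ minimalᶜ ρ k i (⟦ q ⟧ₜ ρ')
      boxᶠ-correct k@(conjunct _ _ _ b) sc@(_ , _ , A<N) =
        minimalᶠ-correct N b A<N (conjunct-simulation k sc D≤c' a) q<c' refl

  negativesᶠ-correct : ∀ {D M} d → Scoped D d → Defines D ρ M V →
                       FOSat T ρ (negativesᶠ M D d) ⇔ All (ConjunctHolds V ρ) (negatives d)
  negativesᶠ-correct d (_ , _ , nsc) M≡V =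
    All-cong-⇔ nsc (λ {k} sc → negativeᶠ-correct k sc) ⇔-∘ ⋀ᶠ-All (negatives d)
    where
      negativeᶠ-correct : ∀ k → ConjunctScoped _ k → FOSat _ _ (negativeᶠ _ _ k) ⇔ ConjunctHolds _ _ k
      negativeᶠ-correct k@(conjunct _ _ φ _) sc@(_ , _ , φ<N) =
        translate-correct N φ φ<N (conjunct-simulation k sc ≤-refl Agree-refl) M≡V

  module _ {E} (u : Untied E) (w : Var) (E<N : VarsBelow N E) (w<N : w < N) where

    private
      d = decompose u id N (var w)
      D = N + slots u
      d-scoped : Scoped D d
      d-scoped = decompose-scoped u E<N (λ h → h) w<N ≤-refl

    correspondentᵘ-sound : FOSat T ρ (correspondentᵘ u N w) → (V : Val T) → RespVal T V → ¬ ST T V ρ (ρ w) E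
    correspondentᵘ-sound α V resp st
      with decompose-complete u E<N (λ h → h) w<N st
    ... | ρ' , a' , H'
      with ∀ᶠ-range-elim N (slots u) α a'
    ... | ρ'' , a'' , reached⇒consistent
      with Holds-stable d d-scoped a'' H'
    ... | ws , bs , ns =
      reached⇒consistent (Equivalence.from (⋀ᶠ-All (witnesses d)) ws)
        (Equivalence.from (negativesᶠ-correct d d-scoped (boxesᶠ-defines d d-scoped))
          (negatives-anti d (minimalOf-⊆ d resp bs) ns))

    correspondentᵘ-complete : ((V : Val T) → RespVal T V → ¬ ST T V ρ (ρ w) E) →
                              FOSat T ρ (correspondentᵘ u N w)
    correspondentᵘ-complete {ρ = ρ} H = ∀ᶠ-range-intro N (slots u) λ ρ' a reached consistent →
      H (minimalOf ρ' d) (minimalOf-resp d)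
        (ST-transport N E E<N (Agree-sym a) (sym (agrees a w<N))
          (decompose-sound u E<N
            ( Equivalence.to (⋀ᶠ-All (witnesses d)) reached
            , minimalOf-boxes d
            , Equivalence.to (negativesᶠ-correct d d-scoped (boxesᶠ-defines d d-scoped)) consistent)))

  correspondent-correct : ∀ {φ} (s : Sahlqvist φ) (w : Var) → VarsBelow N φ → w < N →
                          ((V : Val T) → RespVal T V → ST T V ρ (ρ w) φ) ⇔ FOSat T ρ (correspondent s N w)
  correspondent-correct (¬' u) w E<N w<N =
    mk⇔ (correspondentᵘ-complete u w E<N w<N) (correspondentᵘ-sound u w E<N w<N)
  correspondent-correct (s₁ ∧' s₂) w (φ₁<N , φ₂<N) w<N =
    (correspondent-correct s₁ w φ₁<N w<N ×-⇔ correspondent-correct s₂ w φ₂<N w<N) ⇔-∘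
    mk⇔ (λ H → (λ V resp → proj₁ (H V resp)) , (λ V resp → proj₂ (H V resp)))
        (λ (H₁ , H₂) V resp → H₁ V resp , H₂ V resp)

theorem4p7 : (φ : LTL) → Sahlqvist φ → (w : Var) →
    Σ FO (λ α → (T : TS) (ρ : Env T) →
      ((V : Val T) → RespVal T V → ST T V ρ (ρ w) φ) ⇔ FOSat T ρ α)
theorem4p7 φ s w =
  correspondent s N w ,
  λ T ρ → correspondent-correct N s w
            (VarsBelow-maxVar φ (s≤s (m≤m⊔n (maxVar φ) w))) (s≤s (m≤n⊔m (maxVar φ) w))
  where N = suc (maxVar φ ⊔ w)
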